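{- Let $n,m,k,l$ be positive integers with $m \ge n$. Then $tw(G_{n,m,k,l}) \le n + l$.
   Context: $P_m \times P_n$ denotes the grid graph with vertex set $\{(i,j) \mid 1\le i\le n,\ 1\le j\le m\}$, where $(i,j)$ and $(i',j')$ are adjacent iff $|i-i'|+|j-j'|=1$. The graph $G_{n,m,k,l}$ is obtained from this grid by adding a set $W$ of $l$ new vertices and then, for every vertex $(i,j)$ with $1\le i\le n$, $j\in\{1,m\}$, and every $w\in W$, adding a new path on $2^k-1$ vertices (all such paths pairwise disjoint) together with an edge joining $(i,j)$ to one end of the path and an edge joining the other end of the path to $w$. The treewidth $tw(G)$ is the minimum, over all tree decompositions of $G$, of the maximum bag size minus one. -}

module Defs where

open import Data.Nat using (ℕ; zero; suc; _+_; _∸_; _^_; _≤_; _≡ᵇ_)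
open import Data.Fin using (Fin; toℕ)
open import Data.Bool using (Bool; T; _∨_)
open import Data.Product using (Σ; ∃; _×_; _,_; proj₁)
open import Data.Sum using (_⊎_)
open import Data.Empty using (⊥)
open import Data.Unit using (⊤)
open import Data.List using (List; []; _∷_; length; _∷ʳ_)
open import Data.List.Membership.Propositional using (_∈_)
open import Data.List.Relation.Unary.Unique.Propositional using (Unique)
open import Data.List.Relation.Unary.Linked using (Linked)
open import Relation.Binary.PropositionalEquality using (_≡_)

record Graph : Set₁ where
  field
    V : Set
    E : V → V → Set

data Walk {A : Set} (R : A → A → Set) (P : A → Set) : A → A → Set where
  here  : ∀ {x} → P x → Walk R P x x
  step  : ∀ {x y z} → P x → R x y → Walk R P y z → Walk R P x z

record Tree : Set₁ where
  field
    size   : ℕ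
    TE     : Fin size → Fin size → Set
    sym    : ∀ {x y} → TE x y → TE y x
    irrefl : ∀ {x} → TE x x → ⊥
    connected : ∀ x y → Walk TE (λ _ → ⊤) x y
    acyclic   : ∀ (x : Fin size) (xs : List (Fin size)) → 2 ≤ length xs →
                Unique (x ∷ xs) → Linked TE ((x ∷ xs) ∷ʳ x) → ⊥

-- Bags are lists of vertices; the bag size is the
-- length of the list (duplicates can only increase it, so the existence
-- of a decomposition with all bags of length ≤ w+1 is equivalent to the
-- existence of one with all bags of cardinality ≤ w+1).

record TreeDecomposition (G : Graph) : Set₁ where
  open Graph G
  field
    tree : Tree
  open Tree tree
  field
    bag        : Fin size → List V
    vertexCov  : ∀ v → ∃ λ x → v ∈ bag x
    edgeCov    : ∀ u v → E u v → ∃ λ x → (u ∈ bag x) × (v ∈ bag x)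
    coherent   : ∀ v x y → v ∈ bag x → v ∈ bag y →
                 Walk TE (λ z → v ∈ bag z) x y

TwLeq : Graph → ℕ → Set₁
TwLeq G w = Σ (TreeDecomposition G) λ D →
  ∀ x → length (TreeDecomposition.bag D x) ≤ suc w

-- The graph G_{n,m,k,l}.  Rows i ∈ Fin n, columns j ∈ Fin m (0-indexed,
-- so the paper's columns 1 and m are toℕ j ≡ 0 and toℕ j ≡ m ∸ 1).

isEnd : ∀ {m} → Fin m → Bool
isEnd {m} j = (toℕ j ≡ᵇ 0) ∨ (toℕ j ≡ᵇ (m ∸ 1))

-- the set {1, m} of boundary columns (a single column when m = 1)
EndCol : ℕ → Set
EndCol m = Σ (Fin m) λ j → T (isEnd j)

-- number of vertices on each attached path
pathLen : ℕ → ℕ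
pathLen k = 2 ^ k ∸ 1

data Vtx (n m k l : ℕ) : Set where
  grid : Fin n → Fin m → Vtx n m k l
  hub  : Fin l → Vtx n m k l
  pth  : Fin n → EndCol m → Fin l → Fin (pathLen k) → Vtx n m k l
  -- pth i j w p : the p-th vertex of the path joining (i,j) to w

data Adj (n m k l : ℕ) : Vtx n m k l → Vtx n m k l → Set where
  gridH  : ∀ i j j' → toℕ j' ≡ suc (toℕ j) → Adj n m k l (grid i j) (grid i j')
  gridV  : ∀ i i' j → toℕ i' ≡ suc (toℕ i) → Adj n m k l (grid i j) (grid i' j)
  pathE  : ∀ i e w p p' → toℕ p' ≡ suc (toℕ p) →
           Adj n m k l (pth i e w p) (pth i e w p')
  attachG : ∀ i e w p → toℕ p ≡ 0 →
           Adj n m k l (grid i (proj₁ e)) (pth i e w p)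
  attachW : ∀ i e w p → suc (toℕ p) ≡ pathLen k →
           Adj n m k l (pth i e w p) (hub w)

G : ℕ → ℕ → ℕ → ℕ → Graph
G n m k l = record
  { V = Vtx n m k l
  ; E = λ u v → Adj n m k l u v ⊎ Adj n m k l v u
  }

-- Ordering the grid column by column, the windows of n + 1 consecutive vertices form a path
-- decomposition of P_m × P_n of width n (a vertical edge joins consecutive vertices, a horizontal
-- one vertices n apart); adding W to every window gives width n + l.  Each attached path
-- x₀ … x_{L-1} from a grid vertex g to w ∈ W hangs off a window containing g as a chain of bags
-- {w, x₀, g}, {w, x₁, x₀}, …, {w, x_{L-1}, x_{L-2}}, of size 3 ≤ n + l + 1.  Bags are linked by
-- a rank-decreasing parent function, so they form a tree, and the bags containing a vertex v are
-- connected because each of them except one has a parent bag that also contains v.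

module Submission where

open import Defs
open import Data.Nat using (ℕ; suc; _+_; _*_; _∸_; _≤_; _<_; s≤s; z≤n; s≤s⁻¹)
open import Data.Nat.Properties
open import Data.Nat.Induction using (<-wellFounded)
open import Data.Fin as Fin using (Fin; toℕ; inject₁; fromℕ<; combine; remQuot)
open import Data.Fin.Properties
  using (toℕ-injective; toℕ-inject₁; toℕ-fromℕ<; fromℕ<-toℕ; toℕ<n; toℕ-combine; remQuot-combine; combine-remQuot;
         +↔⊎; *↔×)
open import Data.Maybe as Maybe using (Maybe; just; nothing)
open import Data.Maybe.Properties using (just-injective)
open import Data.Product using (∃; _×_; _,_; proj₁; proj₂; map₁; map₂; swap)
open import Data.Sum using (_⊎_; inj₁; inj₂)
open import Data.Empty using (⊥; ⊥-elim)
open import Data.Unit using (⊤; tt)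
open import Data.List using (List; []; _∷_; _++_; length; _∷ʳ_; map; mapMaybe; applyUpTo; tabulate)
open import Data.List.Properties using (length-++; length-map; length-tabulate; length-applyUpTo; length-mapMaybe)
open import Data.List.Membership.Propositional.Properties
  using (∈-applyUpTo⁺; ∈-applyUpTo⁻; ∈-tabulate⁺; ∈-tabulate⁻; ∈-map⁺; ∈-map⁻; ∈-++⁺ˡ; ∈-++⁺ʳ; ∈-++⁻)
open import Data.List.Relation.Unary.Any using (here; there)
open import Data.List.Relation.Unary.All as All using (All; _∷_)
open import Data.List.Relation.Unary.AllPairs using (_∷_)
open import Data.List.Relation.Unary.Unique.Propositional using (Unique)
open import Data.List.Relation.Unary.Linked as Linked using (Linked; [-]; _∷_)
open import Data.List.Membership.Propositional using (_∈_)
open import Function using (_∘_; _on_)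
open import Function.Bundles using (Inverse; _↔_)
open import Function.Properties.Inverse using (↔-refl; ↔-trans)
open import Data.Sum.Function.Propositional using (_⊎-↔_)
open import Data.Product.Function.NonDependent.Propositional using (_×-↔_)
open import Data.Bool using (T)
open import Data.Bool.Properties using (T-irrelevant)
open import Induction.WellFounded using (Acc; acc)
open import Relation.Binary.Construct.On as On using ()
open import Relation.Binary.Definitions using (Transitive)
open import Relation.Nullary using (¬_; yes; no)
open import Relation.Nullary.Decidable using (T?; dec-yes-irr)
open import Relation.Binary.PropositionalEquality
  using (_≡_; _≢_; refl; sym; trans; cong; cong₂; subst; ≢-sym; module ≡-Reasoning)

module _ {A : Set} {R : A → A → Set} {S : A → Set} where

  walk-start : ∀ {x y} → Walk R S x y → S x
  walk-start (here s)     = s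
  walk-start (step s _ _) = s

  walk-++ : ∀ {x y z} → Walk R S x y → Walk R S y z → Walk R S x z
  walk-++ (here _)     w′ = w′
  walk-++ (step s r w) w′ = step s r (walk-++ w w′)

  walk-reverse : (∀ {x y} → R x y → R y x) → ∀ {x y} → Walk R S x y → Walk R S y x
  walk-reverse sym (here s)     = here s
  walk-reverse sym (step s r w) = walk-++ (walk-reverse sym w) (step (walk-start w) (sym r) (here s))

module _ {A : Set} where

  lastOf : A → List A → A
  lastOf x []       = x
  lastOf _ (y ∷ ys) = lastOf y ys

  lastOf-∈ : ∀ x ys → lastOf x ys ∈ x ∷ ys
  lastOf-∈ x []       = here refl
  lastOf-∈ x (y ∷ ys) = there (lastOf-∈ y ys)

  Linked-lastOf : ∀ {R : A → A → Set} x ys {t} → Linked R (x ∷ ys ∷ʳ t) → R (lastOf x ys) t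
  Linked-lastOf x []       (r ∷ _) = r
  Linked-lastOf x (y ∷ ys) (_ ∷ l) = Linked-lastOf y ys l

  Linked⇒first≺last : ∀ {_≺_ : A → A → Set} → Transitive _≺_ →
                      ∀ x ys {t} → Linked _≺_ (x ∷ ys ∷ʳ t) → x ≺ t
  Linked⇒first≺last ≺-trans x []       (r ∷ _) = r
  Linked⇒first≺last ≺-trans x (y ∷ ys) (r ∷ l) = ≺-trans r (Linked⇒first≺last ≺-trans y ys l)

  NoBacktrack : List A → Set
  NoBacktrack (x ∷ y ∷ z ∷ zs) = x ≢ z × NoBacktrack (y ∷ z ∷ zs)
  NoBacktrack _                = ⊤

  NoBacktrack-tail : ∀ {x} xs → NoBacktrack (x ∷ xs) → NoBacktrack xs
  NoBacktrack-tail (_ ∷ _ ∷ _) (_ , nb) = nb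
  NoBacktrack-tail (_ ∷ [])    _        = tt
  NoBacktrack-tail []          _        = tt

  Unique⇒NoBacktrack-∷ʳ : ∀ {t} xs → Unique xs → All (t ≢_) xs → NoBacktrack (xs ∷ʳ t)
  Unique⇒NoBacktrack-∷ʳ []               _                     _             = tt
  Unique⇒NoBacktrack-∷ʳ (_ ∷ [])         _                     _             = tt
  Unique⇒NoBacktrack-∷ʳ (_ ∷ _ ∷ [])     _                     (t≢x ∷ _)     = ≢-sym t≢x , tt
  Unique⇒NoBacktrack-∷ʳ (_ ∷ y ∷ z ∷ zs) ((_ ∷ x≢z ∷ _) ∷ uniq) (_ ∷ t∉)     =
    x≢z , Unique⇒NoBacktrack-∷ʳ (y ∷ z ∷ zs) uniq t∉

module _ {A B : Set} {f : A → Maybe B} where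

  ∈-mapMaybe⁺ : ∀ {x y} xs → x ∈ xs → f x ≡ just y → y ∈ mapMaybe f xs
  ∈-mapMaybe⁺ (x ∷ xs) (here refl) fx≡y rewrite fx≡y = here refl
  ∈-mapMaybe⁺ (z ∷ xs) (there x∈) fx≡y with f z
  ... | nothing = ∈-mapMaybe⁺ xs x∈ fx≡y
  ... | just _  = there (∈-mapMaybe⁺ xs x∈ fx≡y)

  ∈-mapMaybe⁻ : ∀ {y} xs → y ∈ mapMaybe f xs → ∃ λ x → x ∈ xs × f x ≡ just y
  ∈-mapMaybe⁻ (x ∷ xs) y∈ with f x in fx≡ | y∈
  ... | nothing | y∈′       = map₂ (map₁ there) (∈-mapMaybe⁻ xs y∈′)
  ... | just _  | here refl  = x , here refl , fx≡
  ... | just _  | there y∈′ = map₂ (map₁ there) (∈-mapMaybe⁻ xs y∈′)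

-- x ↑ y : y is the parent of x.
module ParentForest {X : Set} (_↑_ : X → X → Set) (rank : X → ℕ)
                    (↑-functional : ∀ {x y z} → x ↑ y → x ↑ z → y ≡ z)
                    (↑-rank : ∀ {x y} → x ↑ y → rank y < rank x) where

  Edge : X → X → Set
  Edge x y = x ↑ y ⊎ y ↑ x

  edge-sym : ∀ {x y} → Edge x y → Edge y x
  edge-sym (inj₁ p) = inj₂ p
  edge-sym (inj₂ p) = inj₁ p

  edge-irrefl : ∀ {x} → Edge x x → ⊥
  edge-irrefl (inj₁ p) = <-irrefl refl (↑-rank p)
  edge-irrefl (inj₂ p) = <-irrefl refl (↑-rank p)

  _↓_ : X → X → Set
  x ↓ y = y ↑ x

  ¬-ascending-cycle : ∀ x ys → ¬ Linked _↑_ (x ∷ ys ∷ʳ x)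
  ¬-ascending-cycle x ys up =
    <-irrefl refl (Linked⇒first≺last (λ p q → <-trans q p) x ys (Linked.map ↑-rank up))

  ¬-descending-cycle : ∀ x ys → ¬ Linked _↓_ (x ∷ ys ∷ʳ x)
  ¬-descending-cycle x ys down =
    <-irrefl refl (Linked⇒first≺last <-trans x ys (Linked.map ↑-rank down))

  descent-continues : ∀ {x y} zs → NoBacktrack (x ∷ y ∷ zs) → y ↑ x →
                      Linked Edge (y ∷ zs) → Linked _↓_ (x ∷ y ∷ zs)
  descent-continues []       _          y↑x _                = y↑x ∷ [-]
  descent-continues (z ∷ zs) (x≢z , nb) y↑x (inj₁ y↑z ∷ l) = ⊥-elim (x≢z (↑-functional y↑x y↑z))
  descent-continues (z ∷ zs) (x≢z , nb) y↑x (inj₂ z↑y ∷ l) = y↑x ∷ descent-continues zs nb z↑y l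

  ascent-to-end : ∀ x ys {t} → NoBacktrack (x ∷ ys ∷ʳ t) → Linked Edge (x ∷ ys ∷ʳ t) →
                  lastOf x ys ↑ t → Linked _↑_ (x ∷ ys ∷ʳ t)
  ascent-to-end x []       _  _              last↑t = last↑t ∷ [-]
  ascent-to-end x (y ∷ ys) nb (inj₁ x↑y ∷ l) last↑t =
    x↑y ∷ ascent-to-end y ys (NoBacktrack-tail (y ∷ ys ∷ʳ _) nb) l last↑t
  ascent-to-end x (y ∷ ys) nb (inj₂ y↑x ∷ l) last↑t =
    ⊥-elim (<-asym (↑-rank last↑t) (↑-rank t↑last))
    where t↑last = Linked-lastOf y ys (Linked.tail (descent-continues (ys ∷ʳ _) nb y↑x l))

  -- Parents are unique, so a walk without backtracking never steps down to a child and then up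
  -- to a parent; a cycle would therefore be entirely ascending or entirely descending in rank.
  acyclic : ∀ x xs → 2 ≤ length xs → Unique (x ∷ xs) → Linked Edge (x ∷ xs ∷ʳ x) → ⊥
  acyclic x []           ()       _ _
  acyclic x (_ ∷ [])     (s≤s ()) _ _
  acyclic x (y ∷ z ∷ zs) _ (x∉@(_ ∷ x≢z ∷ _) ∷ uniq@(y∉ ∷ _)) cycle =
    turn (Linked.head cycle) (Linked-lastOf y (z ∷ zs) (Linked.tail cycle))
    where
    nb : NoBacktrack (x ∷ (y ∷ z ∷ zs) ∷ʳ x)
    nb = x≢z , Unique⇒NoBacktrack-∷ʳ (y ∷ z ∷ zs) uniq x∉

    turn : Edge x y → Edge (lastOf z zs) x → ⊥
    turn (inj₂ y↑x) _ =
      ¬-descending-cycle x (y ∷ z ∷ zs) (descent-continues (z ∷ zs ∷ʳ x) nb y↑x (Linked.tail cycle))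
    turn (inj₁ x↑y) (inj₁ last↑x) =
      ¬-ascending-cycle x (y ∷ z ∷ zs) (ascent-to-end x (y ∷ z ∷ zs) nb cycle last↑x)
    turn (inj₁ x↑y) (inj₂ x↑last) = All.lookup y∉ (lastOf-∈ z zs) (↑-functional x↑y x↑last)

  module _ (S : X → Set) (c : X) (climb-step : ∀ {x} → S x → x ≡ c ⊎ ∃ λ y → x ↑ y × S y) where

    climb : ∀ {x} → S x → Walk Edge S x c
    climb {x} = go (On.wellFounded rank <-wellFounded x)
      where
      go : ∀ {x} → Acc (_<_ on rank) x → S x → Walk Edge S x c
      go (acc rs) sx with climb-step sx
      ... | inj₁ refl            = here sx
      ... | inj₂ (y , x↑y , sy) = step sx (inj₁ x↑y) (go (rs (↑-rank x↑y)) sy)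

    climb-connects : ∀ {x y} → S x → S y → Walk Edge S x y
    climb-connects sx sy = walk-++ (climb sx) (walk-reverse edge-sym (climb sy))

module RootedDecomposition
  (Γ : Graph) {A : Set} {N : ℕ} (enumeration : Fin N ↔ A)
  (parent : A → Maybe A) (rank : A → ℕ)
  (rank-parent : ∀ {a b} → parent a ≡ just b → rank b < rank a)
  (root : A) (parentless⇒root : ∀ {a} → parent a ≡ nothing → a ≡ root)
  (bag : A → List (Graph.V Γ)) (home : Graph.V Γ → A)
  (home-∋ : ∀ v → v ∈ bag (home v))
  (climb-bag : ∀ {v a} → v ∈ bag a → a ≡ home v ⊎ ∃ λ b → parent a ≡ just b × v ∈ bag b)
  (edge-in-bag : ∀ {u v} → Graph.E Γ u v → ∃ λ a → u ∈ bag a × v ∈ bag a)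
  where

  open Graph Γ
  open Inverse enumeration using () renaming (to to node; from to index)

  node-index : ∀ a → node (index a) ≡ a
  node-index = Inverse.strictlyInverseˡ enumeration

  index-node : ∀ x → index (node x) ≡ x
  index-node = Inverse.strictlyInverseʳ enumeration

  reindex : ∀ (P : A → Set) {a} → P a → P (node (index a))
  reindex P {a} = subst P (sym (node-index a))

  _↑_ : Fin N → Fin N → Set
  x ↑ y = parent (node x) ≡ just (node y)

  ↑-functional : ∀ {x y z} → x ↑ y → x ↑ z → y ≡ z
  ↑-functional {y = y} {z} p q = begin
    y               ≡⟨ sym (index-node y) ⟩
    index (node y)  ≡⟨ cong index (just-injective (trans (sym p) q)) ⟩
    index (node z)  ≡⟨ index-node z ⟩
    z               ∎
    where open ≡-Reasoning

  open ParentForest _↑_ (rank ∘ node) ↑-functional rank-parent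

  reindex-climb : (S : A → Set) (c : A) →
               (∀ {a} → S a → a ≡ c ⊎ ∃ λ b → parent a ≡ just b × S b) →
               ∀ {x} → S (node x) → x ≡ index c ⊎ ∃ λ y → x ↑ y × S (node y)
  reindex-climb S c step-A {x} s with step-A s
  ... | inj₁ x≡c               = inj₁ (trans (sym (index-node x)) (cong index x≡c))
  ... | inj₂ (b , x↑b , s-b) =
    inj₂ (index b , reindex (λ b′ → parent (node x) ≡ just b′) x↑b , reindex S s-b)

  climb-root : ∀ {a} → ⊤ → a ≡ root ⊎ ∃ λ b → parent a ≡ just b × ⊤
  climb-root {a} _ with parent a in eq
  ... | nothing = inj₁ (parentless⇒root eq)
  ... | just b  = inj₂ (b , refl , tt)

  tree : Tree
  tree = record
    { size      = N
    ; TE        = Edge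
    ; sym       = edge-sym
    ; irrefl    = edge-irrefl
    ; connected = λ x y → climb-connects (λ _ → ⊤) (index root) (reindex-climb _ root climb-root) tt tt
    ; acyclic   = acyclic
    }

  treeDecomposition : TreeDecomposition Γ
  treeDecomposition = record
    { tree      = tree
    ; bag       = bag ∘ node
    ; vertexCov = λ v → index (home v) , reindex (λ a → v ∈ bag a) (home-∋ v)
    ; edgeCov   = λ u v uv → let (a , u∈ , v∈) = edge-in-bag uv in
                             index a , reindex (λ a → u ∈ bag a) u∈ , reindex (λ a → v ∈ bag a) v∈
    ; coherent  = λ v x y →
        climb-connects (λ z → v ∈ bag (node z)) (index (home v))
                       (reindex-climb (λ a → v ∈ bag a) (home v) climb-bag)
    }

  twLeq : ∀ {w} → (∀ a → length (bag a) ≤ suc w) → TwLeq Γ w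
  twLeq bag≤ = treeDecomposition , λ x → bag≤ (node x)

predecessor : ∀ {K} → Fin K → Maybe (Fin K)
predecessor Fin.zero    = nothing
predecessor (Fin.suc q) = just (inject₁ q)

predecessor≡nothing⇒0 : ∀ {K} (p : Fin K) → predecessor p ≡ nothing → toℕ p ≡ 0
predecessor≡nothing⇒0 Fin.zero _ = refl

predecessor≡just⇒suc : ∀ {K} (p : Fin K) {q} → predecessor p ≡ just q → toℕ p ≡ suc (toℕ q)
predecessor≡just⇒suc (Fin.suc q) refl = cong suc (sym (toℕ-inject₁ q))

0⇒predecessor≡nothing : ∀ {K} (p : Fin K) → toℕ p ≡ 0 → predecessor p ≡ nothing
0⇒predecessor≡nothing Fin.zero _ = refl

suc⇒predecessor≡just : ∀ {K} (p q : Fin K) → toℕ p ≡ suc (toℕ q) → predecessor p ≡ just q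
suc⇒predecessor≡just (Fin.suc p) q eq = cong just (toℕ-injective (trans (toℕ-inject₁ p) (suc-injective eq)))

module Construction (n m k l : ℕ) (1≤n : 1 ≤ n) (1≤m : 1 ≤ m) (1≤l : 1 ≤ l) where

  V : Set
  V = Vtx n m k l

  L : ℕ
  L = pathLen k

  -- Column-major order: toℕ (cell r c) = n * toℕ c + toℕ r.
  cell : Fin n → Fin m → Fin (m * n)
  cell r c = combine c r

  cellVertex : Fin (m * n) → V
  cellVertex s = grid (proj₂ (remQuot {m} n s)) (proj₁ (remQuot {m} n s))

  cellVertex-cell : ∀ r c → cellVertex (cell r c) ≡ grid r c
  cellVertex-cell r c = cong (λ (c′ , r′) → grid r′ c′) (remQuot-combine c r)

  toℕ-cell-right : ∀ r c c′ → toℕ c′ ≡ suc (toℕ c) → toℕ (cell r c′) ≡ toℕ (cell r c) + n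
  toℕ-cell-right r c c′ c′≡1+c = begin
    toℕ (cell r c′)               ≡⟨ toℕ-combine c′ r ⟩
    n * toℕ c′ + toℕ r            ≡⟨ cong (λ j → n * j + toℕ r) c′≡1+c ⟩
    n * suc (toℕ c) + toℕ r       ≡⟨ cong (_+ toℕ r) (*-suc n (toℕ c)) ⟩
    n + n * toℕ c + toℕ r         ≡⟨ +-assoc n _ _ ⟩
    n + (n * toℕ c + toℕ r)       ≡⟨ +-comm n _ ⟩
    n * toℕ c + toℕ r + n         ≡⟨ cong (_+ n) (sym (toℕ-combine c r)) ⟩
    toℕ (cell r c) + n            ∎
    where open ≡-Reasoning

  toℕ-cell-down : ∀ r r′ c → toℕ r′ ≡ suc (toℕ r) → toℕ (cell r′ c) ≡ toℕ (cell r c) + 1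
  toℕ-cell-down r r′ c r′≡1+r = begin
    toℕ (cell r′ c)               ≡⟨ toℕ-combine c r′ ⟩
    n * toℕ c + toℕ r′            ≡⟨ cong (n * toℕ c +_) r′≡1+r ⟩
    n * toℕ c + suc (toℕ r)       ≡⟨ +-suc (n * toℕ c) (toℕ r) ⟩
    suc (n * toℕ c + toℕ r)       ≡⟨ +-comm 1 _ ⟩
    n * toℕ c + toℕ r + 1         ≡⟨ cong (_+ 1) (sym (toℕ-combine c r)) ⟩
    toℕ (cell r c) + 1            ∎
    where open ≡-Reasoning

  cellAt : ℕ → Maybe (Fin (m * n))
  cellAt i with i <? m * n
  ... | yes i<mn = just (fromℕ< i<mn)
  ... | no _     = nothing

  cellAt-toℕ : ∀ s → cellAt (toℕ s) ≡ just s
  cellAt-toℕ s with toℕ s <? m * n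
  ... | yes s<mn = cong just (fromℕ<-toℕ s s<mn)
  ... | no  s≮mn = ⊥-elim (s≮mn (toℕ<n s))

  cellAt≡just⇒toℕ : ∀ i {s} → cellAt i ≡ just s → toℕ s ≡ i
  cellAt≡just⇒toℕ i eq with i <? m * n
  cellAt≡just⇒toℕ i refl | yes i<mn = toℕ-fromℕ< i<mn

  InWindow : Fin (m * n) → Fin (m * n) → Set
  InWindow t s = toℕ s ∸ n ≤ toℕ t × toℕ t ≤ toℕ s

  window : Fin (m * n) → List (Fin (m * n))
  window t = mapMaybe cellAt (applyUpTo (toℕ t +_) (suc n))

  ∈-window⁺ : ∀ {t s} → InWindow t s → s ∈ window t
  ∈-window⁺ {t} {s} (s∸n≤t , t≤s) =
    ∈-mapMaybe⁺ {f = cellAt} (applyUpTo (toℕ t +_) (suc n))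
      (subst (_∈ applyUpTo (toℕ t +_) (suc n)) (m+[n∸m]≡n t≤s) (∈-applyUpTo⁺ (toℕ t +_) s∸t<1+n))
      (cellAt-toℕ s)
    where
    s≤n+t : toℕ s ≤ n + toℕ t
    s≤n+t = ≤-trans (m≤n+m∸n (toℕ s) n) (+-monoʳ-≤ n s∸n≤t)
    s∸t<1+n : toℕ s ∸ toℕ t < suc n
    s∸t<1+n = s≤s (m≤n+o⇒m∸n≤o (toℕ s) (toℕ t) (subst (toℕ s ≤_) (+-comm n (toℕ t)) s≤n+t))

  InWindow-+ : ∀ {t s} i → toℕ s ≡ toℕ t + i → i ≤ n → InWindow t s
  InWindow-+ {t} i s≡t+i i≤n rewrite s≡t+i =
    m≤n+o⇒m∸n≤o (toℕ t + i) n (subst (toℕ t + i ≤_) (+-comm (toℕ t) n) (+-monoʳ-≤ (toℕ t) i≤n)) ,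
    m≤m+n (toℕ t) i

  InWindow-refl : ∀ s → InWindow s s
  InWindow-refl s = InWindow-+ 0 (sym (+-identityʳ (toℕ s))) z≤n

  ∈-window⁻ : ∀ {t s} → s ∈ window t → InWindow t s
  ∈-window⁻ {t} s∈ with ∈-mapMaybe⁻ {f = cellAt} (applyUpTo (toℕ t +_) (suc n)) s∈
  ... | i , i∈ , cellAt-i≡s with ∈-applyUpTo⁻ (toℕ t +_) i∈
  ...   | j , j<1+n , refl = InWindow-+ j (cellAt≡just⇒toℕ _ cellAt-i≡s) (s≤s⁻¹ j<1+n)

  InWindow-predecessor : ∀ {t s} → InWindow t s → toℕ t ≢ toℕ s ∸ n →
                         ∃ λ t′ → predecessor t ≡ just t′ × InWindow t′ s
  InWindow-predecessor {t} {s} (s∸n≤t , t≤s) t≢s∸n with predecessor t in eq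
  ... | nothing = ⊥-elim (t≢s∸n (trans t≡0 (sym (n≤0⇒n≡0 (subst (toℕ s ∸ n ≤_) t≡0 s∸n≤t)))))
    where t≡0 = predecessor≡nothing⇒0 t eq
  ... | just t′ = t′ , refl , s≤s⁻¹ s∸n<1+t′ , ≤-trans (n≤1+n (toℕ t′)) 1+t′≤s
    where
    t≡1+t′ = predecessor≡just⇒suc t eq
    s∸n<1+t′ : toℕ s ∸ n < suc (toℕ t′)
    s∸n<1+t′ = subst (toℕ s ∸ n <_) t≡1+t′ (≤∧≢⇒< s∸n≤t (≢-sym t≢s∸n))
    1+t′≤s : suc (toℕ t′) ≤ toℕ s
    1+t′≤s = subst (_≤ toℕ s) t≡1+t′ t≤s

  spineHome : Fin (m * n) → Fin (m * n)
  spineHome s = fromℕ< (≤-<-trans (m∸n≤m (toℕ s) n) (toℕ<n s))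

  spineHome-InWindow : ∀ s → InWindow (spineHome s) s
  spineHome-InWindow s rewrite toℕ-fromℕ< (≤-<-trans (m∸n≤m (toℕ s) n) (toℕ<n s)) =
    ≤-refl , m∸n≤m (toℕ s) n

  hubs : List V
  hubs = tabulate hub

  spineBag : Fin (m * n) → List V
  spineBag t = hubs ++ map cellVertex (window t)

  hub∈spineBag : ∀ t w → hub w ∈ spineBag t
  hub∈spineBag t w = ∈-++⁺ˡ (∈-tabulate⁺ w)

  cellVertex∈spineBag : ∀ {t s} → InWindow t s → cellVertex s ∈ spineBag t
  cellVertex∈spineBag iw = ∈-++⁺ʳ hubs (∈-map⁺ cellVertex (∈-window⁺ iw))

  grid∈spineBag : ∀ {t r c} → InWindow t (cell r c) → grid r c ∈ spineBag t
  grid∈spineBag {t} {r} {c} iw = subst (_∈ spineBag t) (cellVertex-cell r c) (cellVertex∈spineBag iw)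

  ∈-spineBag⁻ : ∀ {t v} → v ∈ spineBag t →
                (∃ λ w → v ≡ hub w) ⊎ (∃ λ s → InWindow t s × v ≡ cellVertex s)
  ∈-spineBag⁻ v∈ with ∈-++⁻ hubs v∈
  ... | inj₁ v∈hubs  = inj₁ (∈-tabulate⁻ v∈hubs)
  ... | inj₂ v∈cells = inj₂ (map₂ (map₁ ∈-window⁻) (∈-map⁻ cellVertex v∈cells))

  length-spineBag : ∀ t → length (spineBag t) ≤ suc (n + l)
  length-spineBag t = begin
    length (spineBag t)                           ≡⟨ length-++ hubs ⟩
    length hubs + length (map cellVertex (window t))
                                                  ≡⟨ cong₂ _+_ (length-tabulate {A = V} hub) (length-map cellVertex (window t)) ⟩
    l + length (window t)                         ≤⟨ +-monoʳ-≤ l (length-mapMaybe cellAt (applyUpTo (toℕ t +_) (suc n))) ⟩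
    l + length (applyUpTo (toℕ t +_) (suc n))     ≡⟨ cong (l +_) (length-applyUpTo (toℕ t +_) (suc n)) ⟩
    l + suc n                                     ≡⟨ +-suc l n ⟩
    suc (l + n)                                   ≡⟨ cong suc (+-comm l n) ⟩
    suc (n + l)                                   ∎
    where open ≤-Reasoning

  -- Pendant nodes exist for every column so that Node has an evident enumeration; those off
  -- the end columns get empty bags.
  Node : Set
  Node = Fin (m * n) ⊎ (Fin n × Fin m × Fin l × Fin L)

  enumeration : Fin (m * n + n * (m * (l * L))) ↔ Node
  enumeration = ↔-trans +↔⊎ (↔-refl ⊎-↔ ↔-trans *↔× (↔-refl ×-↔ ↔-trans *↔× (↔-refl ×-↔ *↔×)))

  pendantParent : Fin n → Fin m → Fin l → Maybe (Fin L) → Node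
  pendantParent r c w nothing  = inj₁ (cell r c)
  pendantParent r c w (just q) = inj₂ (r , c , w , q)

  parent : Node → Maybe Node
  parent (inj₁ t)               = Maybe.map inj₁ (predecessor t)
  parent (inj₂ (r , c , w , p)) = just (pendantParent r c w (predecessor p))

  rank : Node → ℕ
  rank (inj₁ t)               = toℕ t
  rank (inj₂ (_ , _ , _ , p)) = m * n + toℕ p

  rank-parent : ∀ {a b} → parent a ≡ just b → rank b < rank a
  rank-parent {inj₁ t} eq with predecessor t in pred≡
  rank-parent {inj₁ t} refl | just t′ = ≤-reflexive (sym (predecessor≡just⇒suc t pred≡))
  rank-parent {inj₂ (r , c , w , p)} eq with predecessor p in pred≡
  rank-parent {inj₂ (r , c , w , p)} refl | nothing = ≤-trans (toℕ<n (cell r c)) (m≤m+n (m * n) (toℕ p))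
  rank-parent {inj₂ (r , c , w , p)} refl | just q  =
    +-monoʳ-< (m * n) (≤-reflexive (sym (predecessor≡just⇒suc p pred≡)))

  root : Fin (m * n)
  root = fromℕ< (*-mono-≤ 1≤m 1≤n)

  toℕ≡0⇒root : ∀ {t} → toℕ t ≡ 0 → t ≡ root
  toℕ≡0⇒root t≡0 = toℕ-injective (trans t≡0 (sym (toℕ-fromℕ< (*-mono-≤ 1≤m 1≤n))))

  parentless⇒root : ∀ {a} → parent a ≡ nothing → a ≡ inj₁ root
  parentless⇒root {inj₁ t} eq with predecessor t in pred≡
  ... | nothing = cong inj₁ (toℕ≡0⇒root (predecessor≡nothing⇒0 t pred≡))

  previous : Fin n → EndCol m → Fin l → Maybe (Fin L) → V
  previous r e w nothing  = grid r (proj₁ e)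
  previous r e w (just q) = pth r e w q

  pathBag : Fin n → EndCol m → Fin l → Fin L → List V
  pathBag r e w p = hub w ∷ pth r e w p ∷ previous r e w (predecessor p) ∷ []

  previous∈pathBag : ∀ {r e w p mq} → predecessor p ≡ mq → previous r e w mq ∈ pathBag r e w p
  previous∈pathBag refl = there (there (here refl))

  pendantBag : Fin n → Fin m → Fin l → Fin L → List V
  pendantBag r c w p with T? (isEnd c)
  ... | yes e = pathBag r (c , e) w p
  ... | no _  = []

  pathBag⊆pendantBag : ∀ {r c w p v} (e : T (isEnd c)) → v ∈ pathBag r (c , e) w p → v ∈ pendantBag r c w p
  pathBag⊆pendantBag {c = c} e v∈ rewrite dec-yes-irr (T? (isEnd c)) T-irrelevant e = v∈

  ∈-pendantBag⁻ : ∀ {r c w p v} → v ∈ pendantBag r c w p → ∃ λ e → v ∈ pathBag r (c , e) w p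
  ∈-pendantBag⁻ {c = c} v∈ with T? (isEnd c)
  ... | yes e = e , v∈

  length-pendantBag : ∀ r c w p → length (pendantBag r c w p) ≤ suc (n + l)
  length-pendantBag r c w p with T? (isEnd c)
  ... | yes _ = s≤s (+-mono-≤ 1≤n 1≤l)
  ... | no  _ = z≤n

  bag : Node → List V
  bag (inj₁ t)               = spineBag t
  bag (inj₂ (r , c , w , p)) = pendantBag r c w p

  home : V → Node
  home (grid r c)          = inj₁ (spineHome (cell r c))
  home (hub w)             = inj₁ root
  home (pth r (c , _) w p) = inj₂ (r , c , w , p)

  home-cellVertex : ∀ s → home (cellVertex s) ≡ inj₁ (spineHome s)
  home-cellVertex s = cong (inj₁ ∘ spineHome) (combine-remQuot {m} n s)

  home-∋ : ∀ v → v ∈ bag (home v)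
  home-∋ (grid r c)          = grid∈spineBag (spineHome-InWindow (cell r c))
  home-∋ (hub w)             = hub∈spineBag root w
  home-∋ (pth r (c , e) w p) = pathBag⊆pendantBag e (there (here refl))

  Climbs : V → Node → Set
  Climbs v a = a ≡ home v ⊎ ∃ λ b → parent a ≡ just b × v ∈ bag b

  climb-spine : ∀ {v t} → v ∈ spineBag t → Climbs v (inj₁ t)
  climb-spine {t = t} v∈ with ∈-spineBag⁻ v∈
  ... | inj₁ (w , refl) with predecessor t in pred≡
  ...   | nothing = inj₁ (cong inj₁ (toℕ≡0⇒root (predecessor≡nothing⇒0 t pred≡)))
  ...   | just t′ = inj₂ (inj₁ t′ , refl , hub∈spineBag t′ w)
  climb-spine {t = t} v∈ | inj₂ (s , iw , refl) with toℕ t ≟ toℕ s ∸ n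
  ... | yes t≡s∸n = inj₁ (trans (cong inj₁ (toℕ-injective t≡home)) (sym (home-cellVertex s)))
    where t≡home = trans t≡s∸n (sym (toℕ-fromℕ< (≤-<-trans (m∸n≤m (toℕ s) n) (toℕ<n s))))
  ... | no  t≢s∸n with InWindow-predecessor iw t≢s∸n
  ...   | t′ , pred≡ , iw′ = inj₂ (inj₁ t′ , cong (Maybe.map inj₁) pred≡ , cellVertex∈spineBag iw′)

  hub∈pendantParent : ∀ {r c w} (e : T (isEnd c)) mq → hub w ∈ bag (pendantParent r c w mq)
  hub∈pendantParent e nothing  = hub∈spineBag _ _
  hub∈pendantParent e (just q) = pathBag⊆pendantBag e (here refl)

  previous∈pendantParent : ∀ {r c w} (e : T (isEnd c)) mq →
                           previous r (c , e) w mq ∈ bag (pendantParent r c w mq)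
  previous∈pendantParent {r} {c} e nothing  = grid∈spineBag (InWindow-refl (cell r c))
  previous∈pendantParent         e (just q) = pathBag⊆pendantBag e (there (here refl))

  climb-pendant : ∀ {v r c w p} → v ∈ pendantBag r c w p → Climbs v (inj₂ (r , c , w , p))
  climb-pendant {p = p} v∈ with ∈-pendantBag⁻ v∈
  ... | e , here refl                 = inj₂ (_ , refl , hub∈pendantParent e (predecessor p))
  ... | e , there (here refl)         = inj₁ refl
  ... | e , there (there (here refl)) = inj₂ (_ , refl , previous∈pendantParent e (predecessor p))

  climb-bag : ∀ {v a} → v ∈ bag a → Climbs v a
  climb-bag {a = inj₁ _} = climb-spine
  climb-bag {a = inj₂ _} = climb-pendant

  adjacent-in-bag : ∀ {u v} → Adj n m k l u v → ∃ λ a → u ∈ bag a × v ∈ bag a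
  adjacent-in-bag (gridH r c c′ c′≡1+c) =
    inj₁ (cell r c) , grid∈spineBag (InWindow-refl _) ,
    grid∈spineBag (InWindow-+ n (toℕ-cell-right r c c′ c′≡1+c) ≤-refl)
  adjacent-in-bag (gridV r r′ c r′≡1+r) =
    inj₁ (cell r c) , grid∈spineBag (InWindow-refl _) ,
    grid∈spineBag (InWindow-+ 1 (toℕ-cell-down r r′ c r′≡1+r) 1≤n)
  adjacent-in-bag (pathE r (c , e) w p p′ p′≡1+p) =
    inj₂ (r , c , w , p′) ,
    pathBag⊆pendantBag e (previous∈pathBag (suc⇒predecessor≡just p′ p p′≡1+p)) ,
    pathBag⊆pendantBag e (there (here refl))
  adjacent-in-bag (attachG r (c , e) w p p≡0) =
    inj₂ (r , c , w , p) ,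
    pathBag⊆pendantBag e (previous∈pathBag (0⇒predecessor≡nothing p p≡0)) ,
    pathBag⊆pendantBag e (there (here refl))
  adjacent-in-bag (attachW r (c , e) w p _) =
    inj₂ (r , c , w , p) , pathBag⊆pendantBag e (there (here refl)) , pathBag⊆pendantBag e (here refl)

  edge-in-bag : ∀ {u v} → Graph.E (G n m k l) u v → ∃ λ a → u ∈ bag a × v ∈ bag a
  edge-in-bag (inj₁ uv) = adjacent-in-bag uv
  edge-in-bag (inj₂ vu) = map₂ swap (adjacent-in-bag vu)

  length-bag : ∀ a → length (bag a) ≤ suc (n + l)
  length-bag (inj₁ t)               = length-spineBag t
  length-bag (inj₂ (r , c , w , p)) = length-pendantBag r c w p

  open RootedDecomposition (G n m k l) enumeration parent rank (λ {a} → rank-parent {a})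
                           (inj₁ root) (λ {a} → parentless⇒root {a}) bag home home-∋ climb-bag edge-in-bag

  tw≤n+l : TwLeq (G n m k l) (n + l)
  tw≤n+l = twLeq length-bag

lemma7 : ∀ (n m k l : ℕ) → 1 ≤ n → 1 ≤ m → 1 ≤ k → 1 ≤ l → n ≤ m →
    TwLeq (G n m k l) (n + l)
lemma7 n m k l 1≤n 1≤m _ 1≤l _ = Construction.tw≤n+l n m k l 1≤n 1≤m 1≤l
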